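{- If $f:\mathbb{N}\to\mathbb{N}$ is defined by an additive circuit, i.e. there is an additive circuit $\sigma(x)$ with $\sigma(\{n\})=\{f(n)\}$ for all $n\in\mathbb{N}$, then $f$ is linearly bounded: there are constants $a,b\in\mathbb{N}$ with $f(n)\le an+b$ for all $n\in\mathbb{N}$.
   Context: $\mathbb{N}=\{0,1,2,\ldots\}$. For $s,t\subseteq\mathbb{N}$, $s\oplus t=\{m+n\mid m\in s,n\in t\}$. An additive circuit is a term built from variables ranging over subsets of $\mathbb{N}$, the constants $\emptyset$, $\mathbb{N}$, $\{n\}$ ($n\in\mathbb{N}$), and the operations $\cup$, $\cap$, complement relative to $\mathbb{N}$, and $\oplus$; it is evaluated in the obvious way. -}

module Defs where

open import Data.Nat using (ℕ; _+_)
open import Data.Product using (∃₂; _×_)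
open import Data.Sum using (_⊎_)
open import Data.Empty using (⊥)
open import Data.Unit using (⊤)
open import Relation.Nullary using (¬_)
open import Relation.Binary.PropositionalEquality using (_≡_)

SetN : Set₁
SetN = ℕ → Set

singleton : ℕ → SetN
singleton n m = m ≡ n

_⊕_ : SetN → SetN → SetN
(s ⊕ t) k = ∃₂ λ m n → (m + n ≡ k) × s m × t n

data Circuit : Set where
  var   : Circuit
  empty : Circuit
  full  : Circuit
  const : ℕ → Circuit
  _∪c_  : Circuit → Circuit → Circuit
  _∩c_  : Circuit → Circuit → Circuit
  compl : Circuit → Circuit
  _⊕c_  : Circuit → Circuit → Circuit

eval : Circuit → SetN → SetN
eval var         s k = s k
eval empty       s k = ⊥
eval full        s k = ⊤
eval (const n)   s k = k ≡ n
eval (σ ∪c τ)    s k = eval σ s k ⊎ eval τ s k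
eval (σ ∩c τ)    s k = eval σ s k × eval τ s k
eval (compl σ)   s k = ¬ eval σ s k
eval (σ ⊕c τ)    s k = (eval σ s ⊕ eval τ s) k

Defines : Circuit → (ℕ → ℕ) → Set
Defines σ f = ∀ n m → (eval σ (singleton n) m → m ≡ f n) × (m ≡ f n → eval σ (singleton n) m)

module Submission where

-- Call a set P ⊆ ℕ *tame above B* if, classically, P is either
-- eventually empty (no element beyond B) or eventually full (every number
-- beyond B is in P).  Being constructive, we work under double negation.
-- Tameness is preserved by ∪, ∩ and complement with the threshold
-- suc (B₁ + B₂) (or B), and — the key point — also by ⊕: a sum with an
-- eventually full summand is eventually full as soon as the other summand
-- is inhabited.  Hence, by induction on the circuit σ, the set σ({n}) is
-- tame above a threshold that is an affine function  slope σ * n + offset σ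
-- of n.  Finally, a singleton {k} can only be tame above B when k ≤ B,
-- which bounds f n by that affine function when σ({n}) = {f n}.

open import Defs
open import Data.Nat using (ℕ; suc; _+_; _*_; _∸_; _≤_; _<_; _≤?_; s≤s)
open import Data.Nat.Properties
open import Data.Nat.Solver using (module +-*-Solver)
open import Data.Product using (Σ; ∃; ∃₂; _×_; _,_; proj₁; proj₂)
open import Data.Sum using (_⊎_; inj₁; inj₂)
open import Data.Unit using (tt)
open import Effect.Monad using (RawMonad)
open import Level using (0ℓ)
open import Relation.Nullary using (¬_; yes; no)
open import Relation.Nullary.Decidable using (decidable-stable; ¬¬-excluded-middle)
open import Relation.Nullary.Negation using (DoubleNegation; ¬¬-Monad; contradiction)
open import Relation.Binary.PropositionalEquality using (_≡_; refl; sym; trans; cong; subst)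

open RawMonad (¬¬-Monad {a = 0ℓ}) using (pure; _>>=_)

EventuallyEmpty : SetN → ℕ → Set
EventuallyEmpty P B = ∀ m → B < m → ¬ P m

EventuallyFull : SetN → ℕ → Set
EventuallyFull P B = ∀ m → B < m → DoubleNegation (P m)

Tame : SetN → ℕ → Set
Tame P B = DoubleNegation (EventuallyEmpty P B ⊎ EventuallyFull P B)

tame-resp : ∀ {P Q B} → (∀ m → P m → Q m) → (∀ m → Q m → P m) → Tame P B → Tame Q B
tame-resp P⊆Q Q⊆P tame = do
  inj₁ noneAbove ← tame
    where inj₂ allAbove → pure (inj₂ λ m lt ¬Qm → allAbove m lt (λ Pm → ¬Qm (P⊆Q m Pm)))
  pure (inj₁ λ m lt Qm → noneAbove m lt (Q⊆P m Qm))

above-left : ∀ B₁ B₂ {m} → suc (B₁ + B₂) < m → B₁ < m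
above-left B₁ B₂ lt = ≤-<-trans (≤-trans (m≤m+n B₁ B₂) (n≤1+n _)) lt

above-right : ∀ B₁ B₂ {m} → suc (B₁ + B₂) < m → B₂ < m
above-right B₁ B₂ lt = ≤-<-trans (≤-trans (m≤n+m B₂ B₁) (n≤1+n _)) lt

eventuallyEmpty-bounded : ∀ {P B} → EventuallyEmpty P B → ∀ i → P i → i ≤ B
eventuallyEmpty-bounded {B = B} noneAbove i Pi with i ≤? B
... | yes i≤B = i≤B
... | no  i≰B = contradiction Pi (noneAbove i (≰⇒> i≰B))

tame-∪ : ∀ {s t B₁ B₂} → Tame s B₁ → Tame t B₂ → Tame (λ k → s k ⊎ t k) (suc (B₁ + B₂))
tame-∪ {s} {t} {B₁} {B₂} tame-s tame-t = do
  x ← tame-s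
  y ← tame-t
  pure (combine x y)
  where
  combine : EventuallyEmpty s B₁ ⊎ EventuallyFull s B₁ → EventuallyEmpty t B₂ ⊎ EventuallyFull t B₂
          → EventuallyEmpty (λ k → s k ⊎ t k) (suc (B₁ + B₂)) ⊎ EventuallyFull (λ k → s k ⊎ t k) (suc (B₁ + B₂))
  combine (inj₁ es) (inj₁ et) = inj₁ λ where
    m lt (inj₁ sm) → es m (above-left B₁ B₂ lt) sm
    m lt (inj₂ tm) → et m (above-right B₁ B₂ lt) tm
  combine (inj₂ fs) _ = inj₂ λ m lt ¬st → fs m (above-left B₁ B₂ lt) (λ sm → ¬st (inj₁ sm))
  combine _ (inj₂ ft) = inj₂ λ m lt ¬st → ft m (above-right B₁ B₂ lt) (λ tm → ¬st (inj₂ tm))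

tame-∩ : ∀ {s t B₁ B₂} → Tame s B₁ → Tame t B₂ → Tame (λ k → s k × t k) (suc (B₁ + B₂))
tame-∩ {s} {t} {B₁} {B₂} tame-s tame-t = do
  x ← tame-s
  y ← tame-t
  pure (combine x y)
  where
  combine : EventuallyEmpty s B₁ ⊎ EventuallyFull s B₁ → EventuallyEmpty t B₂ ⊎ EventuallyFull t B₂
          → EventuallyEmpty (λ k → s k × t k) (suc (B₁ + B₂)) ⊎ EventuallyFull (λ k → s k × t k) (suc (B₁ + B₂))
  combine (inj₁ es) _ = inj₁ λ m lt st → es m (above-left B₁ B₂ lt) (proj₁ st)
  combine _ (inj₁ et) = inj₁ λ m lt st → et m (above-right B₁ B₂ lt) (proj₂ st)
  combine (inj₂ fs) (inj₂ ft) = inj₂ λ m lt ¬st →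
    fs m (above-left B₁ B₂ lt) λ sm → ft m (above-right B₁ B₂ lt) λ tm → ¬st (sm , tm)

tame-compl : ∀ {s B} → Tame s B → Tame (λ k → ¬ s k) B
tame-compl tame = do
  inj₁ noneAbove ← tame
    where inj₂ allAbove → pure (inj₁ allAbove)
  pure (inj₂ λ m lt ¬¬sm → ¬¬sm (noneAbove m lt))

-- The core of the ⊕ case: if i is (doubly negated) in s and t is full above B,
-- then s ⊕ t is full above i + B, witnessed by m = i + (m ∸ i).
⊕-full-above : ∀ {s t B} i → DoubleNegation (s i) → EventuallyFull t B
             → ∀ m → i + B < m → DoubleNegation ((s ⊕ t) m)
⊕-full-above {B = B} i ¬¬si allAbove m lt ¬sum =
  ¬¬si λ si → allAbove (m ∸ i) B<m∸i λ tj → ¬sum (i , m ∸ i , m+[n∸m]≡n i≤m , si , tj)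
  where
  i≤m : i ≤ m
  i≤m = ≤-trans (m≤m+n i B) (<⇒≤ lt)
  B<m∸i : B < m ∸ i
  B<m∸i = subst (_< m ∸ i) (m+n∸m≡n i B) (∸-monoˡ-< lt (m≤m+n i B))

-- An eventually empty set plus an eventually full set: either the first set is
-- empty (then so is the sum), or it has an element i ≤ B₁ and the sum is full.
empty⊕full : ∀ {s t B₁ B₂} → EventuallyEmpty s B₁ → EventuallyFull t B₂ → Tame (s ⊕ t) (suc (B₁ + B₂))
empty⊕full {s} {B₁ = B₁} {B₂ = B₂} noneAbove allAbove = do
  yes (i , si) ← ¬¬-excluded-middle {A = ∃ s}
    where no ¬∃s → pure (inj₁ λ { m lt (i , _ , _ , si , _) → ¬∃s (i , si) })
  let i+B₂<m : ∀ {m} → suc (B₁ + B₂) < m → i + B₂ < m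
      i+B₂<m lt = ≤-<-trans (+-monoˡ-≤ B₂ (eventuallyEmpty-bounded noneAbove i si)) (<-trans (n<1+n _) lt)
  pure (inj₂ λ m lt → ⊕-full-above i (λ ¬si → ¬si si) allAbove m (i+B₂<m lt))

-- ⊕ is commutative, which reduces the full-plus-empty case to empty⊕full.
⊕-swap : ∀ {s t} m → (s ⊕ t) m → (t ⊕ s) m
⊕-swap m (i , j , eq , si , tj) = j , i , trans (+-comm j i) eq , tj , si

tame-⊕ : ∀ {s t B₁ B₂} → Tame s B₁ → Tame t B₂ → Tame (s ⊕ t) (suc (B₁ + B₂))
tame-⊕ {s} {t} {B₁} {B₂} tame-s tame-t = do
  x ← tame-s
  y ← tame-t
  combine x y
  where
  combine : EventuallyEmpty s B₁ ⊎ EventuallyFull s B₁ → EventuallyEmpty t B₂ ⊎ EventuallyFull t B₂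
          → Tame (s ⊕ t) (suc (B₁ + B₂))
  combine (inj₁ es) (inj₁ et) = pure (inj₁ λ { m lt (i , j , refl , si , tj) →
    <⇒≱ lt (≤-trans (+-mono-≤ (eventuallyEmpty-bounded es i si) (eventuallyEmpty-bounded et j tj)) (n≤1+n _)) })
  combine (inj₁ es) (inj₂ ft) = empty⊕full es ft
  combine (inj₂ fs) (inj₁ et) =
    subst (Tame (s ⊕ t)) (cong suc (+-comm B₂ B₁)) (tame-resp (⊕-swap {t}) (⊕-swap {s}) (empty⊕full et fs))
  combine (inj₂ fs) (inj₂ ft) =
    pure (inj₂ (⊕-full-above (suc B₁) (fs (suc B₁) ≤-refl) ft))

threshold : Circuit → ℕ → ℕ
threshold var       n = n
threshold empty     n = 0
threshold full      n = 0
threshold (const k) n = k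
threshold (σ ∪c τ)  n = suc (threshold σ n + threshold τ n)
threshold (σ ∩c τ)  n = suc (threshold σ n + threshold τ n)
threshold (compl σ) n = threshold σ n
threshold (σ ⊕c τ)  n = suc (threshold σ n + threshold τ n)

circuit-tame : ∀ σ n → Tame (eval σ (singleton n)) (threshold σ n)
circuit-tame var       n = pure (inj₁ λ m lt m≡n → <⇒≢ lt (sym m≡n))
circuit-tame empty     n = pure (inj₁ λ m lt ())
circuit-tame full      n = pure (inj₂ λ m lt ¬⊤ → ¬⊤ tt)
circuit-tame (const k) n = pure (inj₁ λ m lt m≡k → <⇒≢ lt (sym m≡k))
circuit-tame (σ ∪c τ)  n = tame-∪ (circuit-tame σ n) (circuit-tame τ n)
circuit-tame (σ ∩c τ)  n = tame-∩ (circuit-tame σ n) (circuit-tame τ n)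
circuit-tame (compl σ) n = tame-compl (circuit-tame σ n)
circuit-tame (σ ⊕c τ)  n = tame-⊕ (circuit-tame σ n) (circuit-tame τ n)

-- The threshold is an affine function of n with these coefficients.
slope : Circuit → ℕ
slope var       = 1
slope empty     = 0
slope full      = 0
slope (const k) = 0
slope (σ ∪c τ)  = slope σ + slope τ
slope (σ ∩c τ)  = slope σ + slope τ
slope (compl σ) = slope σ
slope (σ ⊕c τ)  = slope σ + slope τ

offset : Circuit → ℕ
offset var       = 0
offset empty     = 0
offset full      = 0
offset (const k) = k
offset (σ ∪c τ)  = suc (offset σ + offset τ)
offset (σ ∩c τ)  = suc (offset σ + offset τ)
offset (compl σ) = offset σ
offset (σ ⊕c τ)  = suc (offset σ + offset τ)

affine-sum : ∀ a₁ a₂ b₁ b₂ n → suc ((a₁ * n + b₁) + (a₂ * n + b₂)) ≡ (a₁ + a₂) * n + suc (b₁ + b₂)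
affine-sum = solve 5 (λ a₁ a₂ b₁ b₂ n →
    con 1 :+ ((a₁ :* n :+ b₁) :+ (a₂ :* n :+ b₂)) := (a₁ :+ a₂) :* n :+ (con 1 :+ (b₁ :+ b₂))) refl
  where open +-*-Solver

-- The threshold of a binary node is affine, given that its children's are;
-- proved mutually with threshold-affine below.
binary-affine : ∀ σ τ n → suc (threshold σ n + threshold τ n) ≡ (slope σ + slope τ) * n + suc (offset σ + offset τ)

threshold-affine : ∀ σ n → threshold σ n ≡ slope σ * n + offset σ
threshold-affine var       n = sym (trans (+-identityʳ (1 * n)) (*-identityˡ n))
threshold-affine empty     n = refl
threshold-affine full      n = refl
threshold-affine (const k) n = refl
threshold-affine (σ ∪c τ)  n = binary-affine σ τ n
threshold-affine (σ ∩c τ)  n = binary-affine σ τ n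
threshold-affine (compl σ) n = threshold-affine σ n
threshold-affine (σ ⊕c τ)  n = binary-affine σ τ n

binary-affine σ τ n rewrite threshold-affine σ n | threshold-affine τ n =
  affine-sum (slope σ) (slope τ) (offset σ) (offset τ) n

-- A set whose only element is k can be tame above B only if k ≤ B: above B it
-- is neither empty (it contains k) nor full (it misses suc (k + B)).
singleton-tame-bounded : ∀ {P B k} → (∀ m → P m → m ≡ k) → P k → Tame P B → k ≤ B
singleton-tame-bounded {B = B} {k = k} only-k Pk tame = decidable-stable (k ≤? B) λ k≰B → tame λ where
  (inj₁ noneAbove) → noneAbove k (≰⇒> k≰B) Pk
  (inj₂ allAbove)  → allAbove (suc (k + B)) (s≤s (m≤n+m B k)) λ P[1+k+B] →
    <⇒≢ (s≤s (m≤m+n k B)) (sym (only-k (suc (k + B)) P[1+k+B]))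

theorem10 : (f : ℕ → ℕ) → Σ Circuit (λ σ → Defines σ f) → ∃₂ λ a b → ∀ n → f n ≤ a * n + b
theorem10 f (σ , defines) = slope σ , offset σ , bounded
  where
  bounded : ∀ n → f n ≤ slope σ * n + offset σ
  bounded n = subst (f n ≤_) (threshold-affine σ n)
    (singleton-tame-bounded (λ m → proj₁ (defines n m)) (proj₂ (defines n (f n)) refl) (circuit-tame σ n))
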